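{- If $\vdash G\triangleright N$, $G$ is bounded and $G\parallel\mathcal M$ is balanced, then the session $N\parallel\mathcal M$ is queue-consuming.
   Context: Participants $\mathsf p,\mathsf q,\mathsf r,\mathsf s$; labels $\lambda$. Processes are the possibly infinite but regular terms coinductively generated by $P ::= \mathbf 0 \mid \mathsf p!\{\lambda_i;P_i\}_{i\in I}\mid \mathsf p?\{\lambda_i;P_i\}_{i\in I}$, $I$ finite nonempty, $\lambda_i$ pairwise distinct. A network is $N=\mathsf p_1[\![P_1]\!]\parallel\cdots\parallel\mathsf p_n[\![P_n]\!]$ with $n>0$ and pairwise distinct $\mathsf p_i$, taken modulo permutation and adding/removing components $\mathsf p[\![\mathbf 0]\!]$; $\mathrm{plays}(N)$ is the set of $\mathsf p$ with $N\equiv\mathsf p[\![P]\!]\parallel N'$, $P\neq\mathbf 0$. A message is $\langle\mathsf p,\lambda,\mathsf q\rangle$; a queue $\mathcal M$ is a finite sequence of messages ($\emptyset$, $\cdot$), modulo the congruence $\equiv$ generated by $\langle\mathsf p,\lambda,\mathsf q\rangle\cdot\langle\mathsf r,\lambda',\mathsf s\rangle\equiv\langle\mathsf r,\lambda',\mathsf s\rangle\cdot\langle\mathsf p,\lambda,\mathsf q\rangle$ when $\mathsf p\neq\mathsf r$ or $\mathsf q\neq\mathsf s$. Communications $\beta::=\mathsf p\mathsf q!\lambda\mid\mathsf p\mathsf q?\lambda$, $\mathrm{play}(\mathsf p\mathsf q!\lambda)=\mathsf p$, $\mathrm{play}(\mathsf p\mathsf q?\lambda)=\mathsf q$. Sessions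 $N\parallel\mathcal M$ reduce by: $\mathsf p[\![\mathsf q!\{\lambda_i;P_i\}_{i\in I}]\!]\parallel N\parallel\mathcal M\xrightarrow{\mathsf p\mathsf q!\lambda_h}\mathsf p[\![P_h]\!]\parallel N\parallel\mathcal M\cdot\langle\mathsf p,\lambda_h,\mathsf q\rangle$ and $\mathsf q[\![\mathsf p?\{\lambda_i;Q_i\}_{i\in I}]\!]\parallel N\parallel\langle\mathsf p,\lambda_h,\mathsf q\rangle\cdot\mathcal M\xrightarrow{\mathsf p\mathsf q?\lambda_h}\mathsf q[\![Q_h]\!]\parallel N\parallel\mathcal M$, $h\in I$. Lockstep: a nonempty set $\Delta$ of communications is coherent for a session $S$ if distinct elements of $\Delta$ have distinct players and $S$ has a $\beta$-transition for each $\beta\in\Delta$; $S\Rightarrow_\Delta S'$ if $\Delta=\{\beta_1,\ldots,\beta_n\}$ is a maximal coherent set for $S$ and $S\xrightarrow{\beta_1}\cdots\xrightarrow{\beta_n}S'$. A complete lockstep computation from $S$ is a sequence $S=S_0\Rightarrow_{\Delta_0}S_1\Rightarrow_{\Delta_1}\cdots$ which is infinite or finite with a last session having no transition. $N\parallel\mathcal M$ is queue-consuming if whenever $\mathcal M\equiv\langle\mathsf p,\lambda,\mathsf q\rangle\cdot\mathcal M'$, every complete lockstep computation from $N\parallel\mathcal M$ has a step $h$ with $\mathsf p\mathsf q?\lambda\in\Delta_h$. Global types: possibly infinite regular terms $G ::= \mathsf{End}\mid \mathsf p\mathsf q!\{\lambda_i;G_i\}_{i\in I}\mid\mathsf p\mathsf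 q?\{\lambda_i;G_i\}_{i\in I}$ ($I$ finite nonempty, $\mathsf p\neq\mathsf q$, $\lambda_i$ distinct); $\mathsf p\mathsf q\dagger$ denotes either form. $\mathrm{play}(\mathsf p\mathsf q!\{\ldots\})=\mathsf p$, $\mathrm{play}(\mathsf p\mathsf q?\{\ldots\})=\mathsf q$; $\mathrm{plays}(G)$ least set with $\mathrm{plays}(\mathsf{End})=\emptyset$, $\mathrm{plays}(G)=\{\mathrm{play}(G)\}\cup\bigcup_i\mathrm{plays}(G_i)$. Typing $\vdash G\triangleright N$ (coinductive): (End) $\vdash\mathsf{End}\triangleright\mathsf p[\![\mathbf 0]\!]$; (Out) if $\forall i\in I$: $\vdash G_i\triangleright\mathsf p[\![P_i]\!]\parallel N$ and $\mathrm{plays}(G_i)\setminus\{\mathsf p\}=\mathrm{plays}(N)$, then $\vdash\mathsf p\mathsf q!\{\lambda_i;G_i\}_{i\in I}\triangleright\mathsf p[\![\mathsf q!\{\lambda_i;P_i\}_{i\in I}]\!]\parallel N$; (In) if $I\subseteq J$ and $\forall i\in I$: $\vdash G_i\triangleright\mathsf p[\![P_i]\!]\parallel N$ and $\mathrm{plays}(G_i)\setminus\{\mathsf p\}=\mathrm{plays}(N)$, then $\vdash\mathsf q\mathsf p?\{\lambda_i;G_i\}_{i\in I}\triangleright\mathsf p[\![\mathsf q?\{\lambda_j;P_j\}_{j\in J}]\!]\parallel N$. Boundedness: $\mathrm{Paths}(G)$ is the greatest family with $\mathrm{Paths}(\mathsf{End})=\{\epsilon\}$ and $\mathrm{Paths}(\mathsf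 p\mathsf q\dagger\{\lambda_i;G_i\}_{i\in I})=\bigcup_{i}\{\mathsf p\mathsf q\dagger\lambda_i\cdot\xi\mid\xi\in\mathrm{Paths}(G_i)\}$; $\mathrm{depth}(\xi,\mathsf p)=\inf\{n\mid\mathrm{play}(\xi_n)=\mathsf p\}$ ($\inf\emptyset=\infty$); $\mathrm{depth}(G,\mathsf p)=1+\sup\{\mathrm{depth}(\xi,\mathsf p)\mid\xi\in\mathrm{Paths}(G)\}$ if $\mathsf p\in\mathrm{plays}(G)$, else $0$. $G$ is bounded if $\mathrm{depth}(G',\mathsf p)<\infty$ for all $G'$ occurring in $G$ and all $\mathsf p\in\mathrm{plays}(G')$. Readability $\mathrm{read}(G,\mathcal M)$ (inductive): $\mathrm{read}(G,\emptyset)$; $\mathrm{read}(\mathsf p\mathsf q!\{\lambda_i;G_i\}_{i\in I},\mathcal M)$ if $\mathrm{read}(G_i,\mathcal M)$ $\forall i\in I$; $\mathrm{read}(\mathsf p\mathsf q?\{\lambda_i;G_i\}_{i\in I},\langle\mathsf p,\lambda_h,\mathsf q\rangle\cdot\mathcal M)$ if $h\in I$ and $\mathrm{read}(G_i,\mathcal M)$ $\forall i\in I$; $\mathrm{read}(\mathsf p\mathsf q?\{\lambda_i;G_i\}_{i\in I},\mathcal M)$ if $\mathcal M\not\equiv\langle\mathsf p,\lambda_i,\mathsf q\rangle\cdot\mathcal M'$ for all $i\in I$, $\mathcal M'$, and $\mathrm{read}(G_i,\mathcal M)$ $\forall i\in I$. Balancing (coinductive): $\mathsf{End}\parallel\emptyset$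 is balanced; $G=\mathsf p\mathsf q!\{\lambda_i;G_i\}_{i\in I}$ with $\mathcal M$ is balanced if $\mathrm{read}(G,\mathcal M)$ and each $G_i\parallel\mathcal M\cdot\langle\mathsf p,\lambda_i,\mathsf q\rangle$ is balanced; $G=\mathsf p\mathsf q?\{\lambda_i;G_i\}_{i\in I}$ with $\langle\mathsf p,\lambda_h,\mathsf q\rangle\cdot\mathcal M$, $h\in I$, is balanced if $\mathrm{read}(G,\langle\mathsf p,\lambda_h,\mathsf q\rangle\cdot\mathcal M)$ and $G_h\parallel\mathcal M$ is balanced. -}

module Defs where

open import Data.Nat using (ℕ; zero; suc; _≤_; _<_; _≟_)
open import Data.Bool using (Bool; true; false; T; not)
open import Data.Empty using (⊥)
open import Data.Unit using (⊤)
open import Data.Product using (Σ; ∃; _×_; _,_; proj₁; proj₂)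
open import Data.Sum using (_⊎_; inj₁; inj₂)
open import Data.Maybe using (Maybe; just; nothing)
open import Data.List using (List; []; _∷_; _++_; [_]; map)
open import Data.List.NonEmpty using (List⁺; toList)
open import Data.List.Membership.Propositional using (_∈_)
open import Data.List.Membership.Propositional.Properties using ()
open import Data.List.Relation.Unary.Any using (Any; here; there)
open import Data.List.Relation.Unary.All using (All)
open import Data.List.Relation.Unary.AllPairs using (AllPairs)
open import Data.List.Relation.Unary.Unique.Propositional using (Unique)
open import Data.List.Relation.Binary.Subset.Propositional using (_⊆_)
open import Relation.Nullary using (¬_; yes; no)
open import Relation.Binary.PropositionalEquality using (_≡_; _≢_)

Part : Set
Part = ℕ

Label : Set
Label = ℕ

-- A branching {λᵢ ; Xᵢ}_{i ∈ I}: a finite nonempty list of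
-- (label, continuation) pairs with pairwise distinct labels.
-- The order of the list carries no meaning.

labels : {X : Set} → List⁺ (Label × X) → List Label
labels bs = map proj₁ (toList bs)

_∈B_ : {X : Set} → Label × X → List⁺ (Label × X) → Set
b ∈B bs = b ∈ toList bs

-- Processes (possibly infinite terms; regularity is a separate predicate)

mutual
  data ProcView : Set where
    𝟎    : ProcView
    out  : (q : Part) (bs : List⁺ (Label × Proc)) → Unique (labels bs) → ProcView
    inp  : (q : Part) (bs : List⁺ (Label × Proc)) → Unique (labels bs) → ProcView

  record Proc : Set where
    coinductive
    field view : ProcView

open Proc public

isEnd : ProcView → Bool
isEnd 𝟎 = true
isEnd (out _ _ _) = false
isEnd (inp _ _ _) = false

Active : Proc → Set
Active P = T (not (isEnd (view P)))

data Dir : Set where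
  snd rcv : Dir   -- snd : pq!{…},  rcv : pq?{…}

mutual
  data GTView : Set where
    End : GTView
    com : (p q : Part) (d : Dir) (bs : List⁺ (Label × GT)) →
          Unique (labels bs) → p ≢ q → GTView

  record GT : Set where
    coinductive
    field gview : GTView

open GT public

playOf : Part → Part → Dir → Part
playOf p q snd = p
playOf p q rcv = q

data _∈Plays_ (r : Part) (G : GT) : Set where
  now   : ∀ {p q d bs u n} → gview G ≡ com p q d bs u n → playOf p q d ≡ r → r ∈Plays G
  later : ∀ {p q d bs u n l Gᵢ} → gview G ≡ com p q d bs u n → (l , Gᵢ) ∈B bs →
          r ∈Plays Gᵢ → r ∈Plays G

-- Subterm occurrence and regularity (finitely many subterms up to
-- bisimilarity, i.e. up to equality of infinite terms)

data OccursP (P' : Proc) : Proc → Set where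
  here  : OccursP P' P'
  thereO : ∀ {P q bs u l Pᵢ} → view P ≡ out q bs u → (l , Pᵢ) ∈B bs → OccursP P' Pᵢ → OccursP P' P
  thereI : ∀ {P q bs u l Pᵢ} → view P ≡ inp q bs u → (l , Pᵢ) ∈B bs → OccursP P' Pᵢ → OccursP P' P

data OccursG (G' : GT) : GT → Set where
  here  : OccursG G' G'
  there : ∀ {G p q d bs u n l Gᵢ} → gview G ≡ com p q d bs u n → (l , Gᵢ) ∈B bs →
          OccursG G' Gᵢ → OccursG G' G

-- Bisimilarity (equality of possibly infinite terms); branchings are
-- compared as sets of (label, continuation) pairs.
mutual
  record _≈P_ (P Q : Proc) : Set where
    coinductive
    field unfoldP : ViewBisim (view P) (view Q)

  data ViewBisim : ProcView → ProcView → Set where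
    𝟎   : ViewBisim 𝟎 𝟎
    out : ∀ {q bs cs u v} → BranchBisimP bs cs → ViewBisim (out q bs u) (out q cs v)
    inp : ∀ {q bs cs u v} → BranchBisimP bs cs → ViewBisim (inp q bs u) (inp q cs v)

  record BranchBisimP (bs cs : List⁺ (Label × Proc)) : Set where
    inductive
    field
      left  : ∀ {l P} → (l , P) ∈B bs → Σ Proc λ Q → (l , Q) ∈B cs × P ≈P Q
      right : ∀ {l Q} → (l , Q) ∈B cs → Σ Proc λ P → (l , P) ∈B bs × P ≈P Q

mutual
  record _≈G_ (G H : GT) : Set where
    coinductive
    field unfoldG : GViewBisim (gview G) (gview H)

  data GViewBisim : GTView → GTView → Set where
    End : GViewBisim End End
    com : ∀ {p q d bs cs u v n m} → BranchBisimG bs cs →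
          GViewBisim (com p q d bs u n) (com p q d cs v m)

  record BranchBisimG (bs cs : List⁺ (Label × GT)) : Set where
    inductive
    field
      left  : ∀ {l G} → (l , G) ∈B bs → Σ GT λ H → (l , H) ∈B cs × G ≈G H
      right : ∀ {l H} → (l , H) ∈B cs → Σ GT λ G → (l , G) ∈B bs × G ≈G H

RegularP : Proc → Set
RegularP P = Σ (List Proc) λ L → ∀ P' → OccursP P' P → Any (P' ≈P_) L

RegularG : GT → Set
RegularG G = Σ (List GT) λ L → ∀ G' → OccursG G' G → Any (G' ≈G_) L

-- Networks: finitely supported maps from participants to processes
-- (this is exactly a network modulo permutation and p[[0]] components)

record Network : Set where
  field
    proc : Part → Proc
    supp : List Part
    fin  : ∀ r → Active (proc r) → r ∈ supp

open Network public

_[_↦_] : Network → Part → Proc → Network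
proc (N [ p ↦ P ]) r with r ≟ p
... | yes _ = P
... | no  _ = proc N r
supp (N [ p ↦ P ]) = p ∷ supp N
fin  (N [ p ↦ P ]) r a with r ≟ p
... | yes r≡p = here r≡p
... | no  _   = there (fin N r a)

_∈PlaysN_ : Part → Network → Set
r ∈PlaysN N = Active (proc N r)

record Msg : Set where
  constructor ⟨_,_,_⟩
  field
    from  : Part
    lab   : Label
    to    : Part

Queue : Set
Queue = List Msg

Indep : Msg → Msg → Set
Indep ⟨ p , _ , q ⟩ ⟨ r , _ , s ⟩ = p ≢ r ⊎ q ≢ s

data _≈Q_ : Queue → Queue → Set where
  reflQ  : ∀ {M} → M ≈Q M
  symQ   : ∀ {M M'} → M ≈Q M' → M' ≈Q M
  transQ : ∀ {M M' M''} → M ≈Q M' → M' ≈Q M'' → M ≈Q M''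
  swapQ  : ∀ xs ys m m' → Indep m m' → (xs ++ m ∷ m' ∷ ys) ≈Q (xs ++ m' ∷ m ∷ ys)

record Session : Set where
  constructor _∥_
  field
    net   : Network
    queue : Queue

open Session public

data Comm : Set where
  _⟶_!_ : Part → Part → Label → Comm
  _⟶_¿_ : Part → Part → Label → Comm

play : Comm → Part
play (p ⟶ q ! _) = p
play (p ⟶ q ¿ _) = q

data _─[_]→_ : Session → Comm → Session → Set where
  send : ∀ {N M p q bs u l P} →
         view (proc N p) ≡ out q bs u → (l , P) ∈B bs →
         (N ∥ M) ─[ p ⟶ q ! l ]→ ((N [ p ↦ P ]) ∥ (M ++ [ ⟨ p , l , q ⟩ ]))
  recv : ∀ {N M M' p q bs u l Q} →
         view (proc N q) ≡ inp p bs u → (l , Q) ∈B bs →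
         M ≈Q (⟨ p , l , q ⟩ ∷ M') →
         (N ∥ M) ─[ p ⟶ q ¿ l ]→ ((N [ q ↦ Q ]) ∥ M')

HasTrans : Session → Comm → Set
HasTrans S β = Σ Session λ S' → S ─[ β ]→ S'

Stuck : Session → Set
Stuck S = ∀ β → ¬ HasTrans S β

-- sets of communications are represented by lists
Coherent : Session → List Comm → Set
Coherent S Δ = (¬ Δ ≡ []) × AllPairs (λ β β' → play β ≢ play β') Δ × All (HasTrans S) Δ

MaxCoherent : Session → List Comm → Set
MaxCoherent S Δ = Coherent S Δ × (∀ Δ' → Coherent S Δ' → Δ ⊆ Δ' → Δ' ⊆ Δ)

data Steps : Session → List Comm → Session → Set where
  []  : ∀ {S} → Steps S [] S
  _∷_ : ∀ {S S₁ S' β Δ} → S ─[ β ]→ S₁ → Steps S₁ Δ S' → Steps S (β ∷ Δ) S'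

_⇒[_]_ : Session → List Comm → Session → Set
S ⇒[ Δ ] S' = MaxCoherent S Δ × Steps S Δ S'

-- Complete lockstep computations  S = S₀ ⇒_{Δ₀} S₁ ⇒_{Δ₁} ⋯
-- (nxt i = S_{i+1}); either finite of length k ending in a stuck session,
-- or infinite.
-- S_i, given S₀ = S and S_{i+1} = nxt i
curFrom : Session → (ℕ → Session) → ℕ → Session
curFrom S nxt zero    = S
curFrom S nxt (suc i) = nxt i

record Complete (S : Session) : Set where
  field
    nxt : ℕ → Session
    Δ   : ℕ → List Comm
  field
    shape : (Σ ℕ λ k → (∀ i → i < k → curFrom S nxt i ⇒[ Δ i ] curFrom S nxt (suc i))
                     × Stuck (curFrom S nxt k))
          ⊎ (∀ i → curFrom S nxt i ⇒[ Δ i ] curFrom S nxt (suc i))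

IsStep : ∀ {S} → Complete S → ℕ → Set
IsStep c h with Complete.shape c
... | inj₁ (k , _) = h < k
... | inj₂ _       = ⊤

QueueConsuming : Session → Set
QueueConsuming (N ∥ M) =
  ∀ p l q M' → M ≈Q (⟨ p , l , q ⟩ ∷ M') →
  (c : Complete (N ∥ M)) → Σ ℕ λ h → IsStep c h × ((p ⟶ q ¿ l) ∈ Complete.Δ c h)

SamePlays : GT → Part → Network → Set
SamePlays G p N = ∀ r → ((r ∈Plays G × r ≢ p) → (r ∈PlaysN N × r ≢ p))
                      × ((r ∈PlaysN N × r ≢ p) → (r ∈Plays G × r ≢ p))

mutual
  record ⊢_▷_ (G : GT) (N : Network) : Set where
    coinductive
    field rule : Rule G N

  data Rule (G : GT) (N : Network) : Set where
    tEnd : gview G ≡ End → (∀ r → ¬ (r ∈PlaysN N)) → Rule G N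
    tOut : ∀ {p q Gbs u n Pbs v} →
           gview G ≡ com p q snd Gbs u n →
           view (proc N p) ≡ out q Pbs v →
           (∀ {l Gᵢ} → (l , Gᵢ) ∈B Gbs →
              Σ Proc λ Pᵢ → (l , Pᵢ) ∈B Pbs × (⊢ Gᵢ ▷ (N [ p ↦ Pᵢ ])) × SamePlays Gᵢ p N) →
           (∀ {l Pᵢ} → (l , Pᵢ) ∈B Pbs → Σ GT λ Gᵢ → (l , Gᵢ) ∈B Gbs) →
           Rule G N
    tIn  : ∀ {p q Gbs u n Pbs v} →
           gview G ≡ com q p rcv Gbs u n →
           view (proc N p) ≡ inp q Pbs v →
           (∀ {l Gᵢ} → (l , Gᵢ) ∈B Gbs →
              Σ Proc λ Pᵢ → (l , Pᵢ) ∈B Pbs × (⊢ Gᵢ ▷ (N [ p ↦ Pᵢ ])) × SamePlays Gᵢ p N) →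
           Rule G N

Act : Set
Act = Part × Part × Dir × Label

playA : Act → Part
playA (p , q , d , _) = playOf p q d

Seq : Set
Seq = ℕ → Maybe Act     -- finite (nothing from some point on) or infinite

shift : Seq → Seq
shift ξ n = ξ (suc n)

mutual
  record _∈Paths_ (ξ : Seq) (G : GT) : Set where
    coinductive
    field unfoldPath : PathStep ξ G

  data PathStep (ξ : Seq) (G : GT) : Set where
    pEnd : gview G ≡ End → (∀ n → ξ n ≡ nothing) → PathStep ξ G
    pCom : ∀ {p q d bs u n l Gᵢ} → gview G ≡ com p q d bs u n → (l , Gᵢ) ∈B bs →
           ξ zero ≡ just (p , q , d , l) → shift ξ ∈Paths Gᵢ → PathStep ξ G

-- depth(ξ,p) ≤ n   (depth = inf of the positions whose player is p)
DepthLE : Seq → Part → ℕ → Set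
DepthLE ξ p n = Σ ℕ λ k → k ≤ n × Σ Act λ β → ξ k ≡ just β × playA β ≡ p

-- depth(G,p) < ∞  (for p ∈ plays(G)): the sup over paths is finite
DepthFinite : GT → Part → Set
DepthFinite G p = Σ ℕ λ n → ∀ ξ → ξ ∈Paths G → DepthLE ξ p n

Bounded : GT → Set
Bounded G = ∀ G' → OccursG G' G → ∀ p → p ∈Plays G' → DepthFinite G' p

data Read (G : GT) : Queue → Set where
  rEmp : Read G []
  rOut : ∀ {M p q bs u n} → gview G ≡ com p q snd bs u n →
         (∀ {l Gᵢ} → (l , Gᵢ) ∈B bs → Read Gᵢ M) → Read G M
  rHit : ∀ {M M' p q bs u n l Gₕ} → gview G ≡ com p q rcv bs u n →
         M ≈Q (⟨ p , l , q ⟩ ∷ M') → (l , Gₕ) ∈B bs →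
         (∀ {l' Gᵢ} → (l' , Gᵢ) ∈B bs → Read Gᵢ M') → Read G M
  rMiss : ∀ {M p q bs u n} → gview G ≡ com p q rcv bs u n →
         (∀ {l Gᵢ} M' → (l , Gᵢ) ∈B bs → ¬ (M ≈Q (⟨ p , l , q ⟩ ∷ M'))) →
         (∀ {l Gᵢ} → (l , Gᵢ) ∈B bs → Read Gᵢ M) → Read G M

mutual
  record Balanced (G : GT) (M : Queue) : Set where
    coinductive
    field unfoldBal : BalStep G M

  data BalStep (G : GT) (M : Queue) : Set where
    bEnd : gview G ≡ End → M ≡ [] → BalStep G M
    bOut : ∀ {p q bs u n} → gview G ≡ com p q snd bs u n → Read G M →
           (∀ {l Gᵢ} → (l , Gᵢ) ∈B bs → Balanced Gᵢ (M ++ [ ⟨ p , l , q ⟩ ])) →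
           BalStep G M
    bIn  : ∀ {p q bs u n l Gₕ M'} → gview G ≡ com p q rcv bs u n →
           M ≈Q (⟨ p , l , q ⟩ ∷ M') → (l , Gₕ) ∈B bs → Read G M →
           Balanced Gₕ M' → BalStep G M

-- Fix a message ⟨p,l,q⟩ at the head of channel p→q. Along a lockstep computation the
-- session S is shadowed by a virtual session typed by a continuation G of the global type
-- and balanced with G, from which S is reached by a list Π of communications that G has
-- not yet absorbed. Pending communications of distinct players commute channelwise, so
-- the root of G can absorb the first pending action of its player, keeping the invariant.
-- Readability, being inductive, bounds by some n the depth at which every branch of G
-- reaches a p q ? node. When nothing more can be absorbed, the root player of G is enabled
-- in S, so by maximality every lockstep step performs one of its actions; absorbing it
-- lowers n, unless the root is p q ?, where the only enabled action of q is to receive l.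
-- Hence p q ? l is performed within n + 1 steps, and no computation stops before.

module Submission where

open import Defs
open import Data.Empty using (⊥-elim)
open import Data.List using (List; []; _∷_; _++_; [_]; map; filter)
open import Data.List.Membership.Propositional using (_∈_; _∉_; find)
open import Data.List.Membership.Propositional.Properties using (∈-map⁺)
open import Data.List.NonEmpty using (List⁺; toList)
open import Data.List.Properties
  using (++-assoc; ++-identityʳ; ++-cancelˡ; ∷-injectiveˡ; map-++; filter-++; filter-accept; filter-reject)
open import Data.List.Relation.Unary.All as All using (All; []; _∷_)
open import Data.List.Relation.Unary.All.Properties using (¬Any⇒All¬; ++⁺)
open import Data.List.Relation.Unary.AllPairs using ([]; _∷_)
open import Data.List.Relation.Unary.Any as Any using (Any; here; there; any?)
open import Data.List.Relation.Unary.Any.Properties using (++⁺ʳ)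
open import Data.List.Relation.Unary.Unique.Propositional using (Unique)
open import Data.Nat using (ℕ; suc; _≤_; _<_; _≟_; z≤n; s≤s; _⊔_)
open import Data.Nat.Properties using (m≤m⊔n; m≤n⊔m; n≤1+n; m≤n⇒m<n∨m≡n)
open import Data.Product using (Σ; ∃; _×_; _,_; proj₁; proj₂)
open import Data.Sum using (_⊎_; inj₁; inj₂; [_,_]′) renaming (map to ⊎-map)
open import Data.Unit using (tt)
open import Function using (_∘_)
open import Relation.Binary.Bundles using (Setoid)
open import Relation.Binary.Definitions using (DecidableEquality)
open import Relation.Binary.PropositionalEquality
  using (_≡_; _≢_; refl; sym; trans; cong; cong₂; subst; module ≡-Reasoning)
import Relation.Binary.Reasoning.Setoid as SetoidReasoning
open import Relation.Nullary using (¬_; yes; no; Dec)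
open import Relation.Nullary.Decidable using (_×-dec_; map′)

-- Channels and channelwise equality of queues

OnChannel : Part → Part → Msg → Set
OnChannel a b m = Msg.from m ≡ a × Msg.to m ≡ b

onChannel? : ∀ a b m → Dec (OnChannel a b m)
onChannel? a b m = (Msg.from m ≟ a) ×-dec (Msg.to m ≟ b)

channel : Part → Part → Queue → List Label
channel a b M = map Msg.lab (filter (onChannel? a b) M)

channel-++ : ∀ a b M M' → channel a b (M ++ M') ≡ channel a b M ++ channel a b M'
channel-++ a b M M' =
  trans (cong (map Msg.lab) (filter-++ (onChannel? a b) M M')) (map-++ Msg.lab (filter (onChannel? a b) M) _)

channel-here : ∀ a b l M → channel a b (⟨ a , l , b ⟩ ∷ M) ≡ l ∷ channel a b M
channel-here a b l M = cong (map Msg.lab) (filter-accept (onChannel? a b) (refl , refl))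

channel-there : ∀ a b m M → ¬ OnChannel a b m → channel a b (m ∷ M) ≡ channel a b M
channel-there a b m M off = cong (map Msg.lab) (filter-reject (onChannel? a b) off)

infix 4 _≃_
record _≃_ (M M' : Queue) : Set where
  constructor channelwise
  field at : ∀ a b → channel a b M ≡ channel a b M'
open _≃_

≃-setoid : Setoid _ _
≃-setoid = record
  { Carrier       = Queue
  ; _≈_           = _≃_
  ; isEquivalence = record
    { refl  = channelwise λ a b → refl
    ; sym   = λ e → channelwise λ a b → sym (at e a b)
    ; trans = λ e e' → channelwise λ a b → trans (at e a b) (at e' a b) } }

open Setoid ≃-setoid using () renaming (refl to ≃-refl; sym to ≃-sym; trans to ≃-trans)

≡⇒≃ : ∀ {M M'} → M ≡ M' → M ≃ M'
≡⇒≃ refl = ≃-refl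

++-cong : ∀ {M₁ M₂ M₃ M₄} → M₁ ≃ M₂ → M₃ ≃ M₄ → M₁ ++ M₃ ≃ M₂ ++ M₄
++-cong {M₁} {M₂} {M₃} {M₄} e e' = channelwise λ a b →
  trans (channel-++ a b M₁ M₃) (trans (cong₂ _++_ (at e a b) (at e' a b)) (sym (channel-++ a b M₂ M₄)))

indep⇒off-channel : ∀ a b {m m'} → Indep m m' → ¬ OnChannel a b m ⊎ ¬ OnChannel a b m'
indep⇒off-channel a b {⟨ x , _ , y ⟩} {⟨ x' , _ , y' ⟩} ind with (x ≟ a) ×-dec (y ≟ b)
... | no off            = inj₁ off
... | yes (refl , refl) = inj₂ λ { (refl , refl) → [ (λ ne → ne refl) , (λ ne → ne refl) ]′ ind }

off-channel⇒indep : ∀ {a b l m} → ¬ OnChannel a b m → Indep m ⟨ a , l , b ⟩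
off-channel⇒indep {a} {m = ⟨ x , _ , _ ⟩} off with x ≟ a
... | no x≢a  = inj₁ x≢a
... | yes x≡a = inj₂ λ y≡b → off (x≡a , y≡b)

++-comm-[] : ∀ {A : Set} {u v : List A} → u ≡ [] ⊎ v ≡ [] → u ++ v ≡ v ++ u
++-comm-[] (inj₁ refl) = sym (++-identityʳ _)
++-comm-[] (inj₂ refl) = ++-identityʳ _

indep-swap : ∀ {m m'} → Indep m m' → m ∷ m' ∷ [] ≃ m' ∷ m ∷ []
indep-swap {m} {m'} ind = channelwise λ a b → begin
  channel a b (m ∷ m' ∷ [])               ≡⟨ channel-++ a b [ m ] [ m' ] ⟩
  channel a b [ m ] ++ channel a b [ m' ] ≡⟨ ++-comm-[] (⊎-map (channel-there a b m []) (channel-there a b m' [])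
                                                             (indep⇒off-channel a b {m} {m'} ind)) ⟩
  channel a b [ m' ] ++ channel a b [ m ] ≡⟨ channel-++ a b [ m' ] [ m ] ⟨
  channel a b (m' ∷ m ∷ [])               ∎
  where open ≡-Reasoning

≈Q⇒≃ : ∀ {M M'} → M ≈Q M' → M ≃ M'
≈Q⇒≃ reflQ                 = ≃-refl
≈Q⇒≃ (symQ e)              = ≃-sym (≈Q⇒≃ e)
≈Q⇒≃ (transQ e e')         = ≃-trans (≈Q⇒≃ e) (≈Q⇒≃ e')
≈Q⇒≃ (swapQ xs ys _ _ ind) = ++-cong (≃-refl {xs}) (++-cong (indep-swap ind) (≃-refl {ys}))

∷-cancel : ∀ {a b l l' M M'} → ⟨ a , l , b ⟩ ∷ M ≃ ⟨ a , l' , b ⟩ ∷ M' → l ≡ l' × M ≃ M'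
∷-cancel {a} {b} {l} {l'} {M} {M'} e with heads-equal
  where
  heads-equal : l ≡ l'
  heads-equal = ∷-injectiveˡ (trans (sym (channel-here a b l M)) (trans (at e a b) (channel-here a b l' M')))
... | refl = refl , channelwise λ c d → ++-cancelˡ (channel c d [ μ ]) _ _
  (trans (sym (channel-++ c d [ μ ] M)) (trans (at e c d) (channel-++ c d [ μ ] M')))
  where μ = ⟨ a , l , b ⟩

≈Q-cons : ∀ {M M'} m → M ≈Q M' → (m ∷ M) ≈Q (m ∷ M')
≈Q-cons m reflQ                   = reflQ
≈Q-cons m (symQ e)                = symQ (≈Q-cons m e)
≈Q-cons m (transQ e e')           = transQ (≈Q-cons m e) (≈Q-cons m e')
≈Q-cons m (swapQ xs ys m₁ m₂ ind) = swapQ (m ∷ xs) ys m₁ m₂ ind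

channel-head : ∀ a b {l t} M → channel a b M ≡ l ∷ t → Σ Queue λ M' → M ≈Q (⟨ a , l , b ⟩ ∷ M')
channel-head a b [] ()
channel-head a b {l} (m ∷ M) e with onChannel? a b m
channel-head a b (⟨ _ , l' , _ ⟩ ∷ M) e | yes (refl , refl)
  with refl ← ∷-injectiveˡ (trans (sym (channel-here a b l' M)) e) = M , reflQ
... | no off with channel-head a b M (trans (sym (channel-there a b m M off)) e)
... | M' , M≈ = m ∷ M' , transQ (≈Q-cons m M≈) (swapQ [] M' m _ (off-channel⇒indep {a} {b} {l} {m} off))

-- Pending communications

outbox : List Comm → Queue
outbox []                 = []
outbox ((x ⟶ y ! l) ∷ Π) = ⟨ x , l , y ⟩ ∷ outbox Π
outbox ((_ ⟶ _ ¿ _) ∷ Π) = outbox Π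

inbox : List Comm → Queue
inbox []                 = []
inbox ((_ ⟶ _ ! _) ∷ Π) = inbox Π
inbox ((x ⟶ y ¿ l) ∷ Π) = ⟨ x , l , y ⟩ ∷ inbox Π

outbox-++ : ∀ Π Π' → outbox (Π ++ Π') ≡ outbox Π ++ outbox Π'
outbox-++ []                 Π' = refl
outbox-++ ((x ⟶ y ! l) ∷ Π) Π' = cong (⟨ x , l , y ⟩ ∷_) (outbox-++ Π Π')
outbox-++ ((_ ⟶ _ ¿ _) ∷ Π) Π' = outbox-++ Π Π'

inbox-++ : ∀ Π Π' → inbox (Π ++ Π') ≡ inbox Π ++ inbox Π'
inbox-++ []                 Π' = refl
inbox-++ ((_ ⟶ _ ! _) ∷ Π) Π' = inbox-++ Π Π'
inbox-++ ((x ⟶ y ¿ l) ∷ Π) Π' = cong (⟨ x , l , y ⟩ ∷_) (inbox-++ Π Π')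

inbox-idle : ∀ {s r} Π → All (λ β → play β ≢ r) Π → channel s r (inbox Π) ≡ []
inbox-idle []                 []          = refl
inbox-idle ((_ ⟶ _ ! _) ∷ Π) (_ ∷ idle) = inbox-idle Π idle
inbox-idle {s} {r} ((x ⟶ y ¿ l) ∷ Π) (y≢r ∷ idle) =
  trans (channel-there s r ⟨ x , l , y ⟩ (inbox Π) (y≢r ∘ proj₂)) (inbox-idle Π idle)

infix 4 _∼_
record _∼_ (Π Π' : List Comm) : Set where
  field
    outboxes : outbox Π ≃ outbox Π'
    inboxes  : inbox Π ≃ inbox Π'
open _∼_

∼-refl : ∀ {Π} → Π ∼ Π
∼-refl = record { outboxes = ≃-refl ; inboxes = ≃-refl }

∼-trans : ∀ {Π₁ Π₂ Π₃} → Π₁ ∼ Π₂ → Π₂ ∼ Π₃ → Π₁ ∼ Π₃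
∼-trans e e' = record
  { outboxes = ≃-trans (outboxes e) (outboxes e')
  ; inboxes  = ≃-trans (inboxes e) (inboxes e') }

∷-∼-cong : ∀ β {Π Π'} → Π ∼ Π' → β ∷ Π ∼ β ∷ Π'
∷-∼-cong β {Π} {Π'} e = record
  { outboxes = ≃-trans (≡⇒≃ (outbox-++ [ β ] Π))
                 (≃-trans (++-cong ≃-refl (outboxes e)) (≡⇒≃ (sym (outbox-++ [ β ] Π'))))
  ; inboxes  = ≃-trans (≡⇒≃ (inbox-++ [ β ] Π))
                 (≃-trans (++-cong ≃-refl (inboxes e)) (≡⇒≃ (sym (inbox-++ [ β ] Π')))) }

swap-∼ : ∀ {β β'} Π → play β ≢ play β' → β ∷ β' ∷ Π ∼ β' ∷ β ∷ Π
swap-∼ {β} {β'} Π ne = record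
  { outboxes = ≃-trans (≡⇒≃ (outbox-++ (β ∷ β' ∷ []) Π))
                 (≃-trans (++-cong (outbox-swap β β' ne) ≃-refl)
                          (≡⇒≃ (sym (outbox-++ (β' ∷ β ∷ []) Π))))
  ; inboxes  = ≃-trans (≡⇒≃ (inbox-++ (β ∷ β' ∷ []) Π))
                 (≃-trans (++-cong (inbox-swap β β' ne) ≃-refl)
                          (≡⇒≃ (sym (inbox-++ (β' ∷ β ∷ []) Π)))) }
  where
  outbox-swap : ∀ β β' → play β ≢ play β' → outbox (β ∷ β' ∷ []) ≃ outbox (β' ∷ β ∷ [])
  outbox-swap (_ ⟶ _ ! _) (_ ⟶ _ ! _) ne = indep-swap (inj₁ ne)
  outbox-swap (_ ⟶ _ ! _) (_ ⟶ _ ¿ _) _  = ≃-refl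
  outbox-swap (_ ⟶ _ ¿ _) (_ ⟶ _ ! _) _  = ≃-refl
  outbox-swap (_ ⟶ _ ¿ _) (_ ⟶ _ ¿ _) _  = ≃-refl
  inbox-swap : ∀ β β' → play β ≢ play β' → inbox (β ∷ β' ∷ []) ≃ inbox (β' ∷ β ∷ [])
  inbox-swap (_ ⟶ _ ¿ _) (_ ⟶ _ ¿ _) ne = indep-swap (inj₂ ne)
  inbox-swap (_ ⟶ _ ! _) (_ ⟶ _ ! _) _  = ≃-refl
  inbox-swap (_ ⟶ _ ! _) (_ ⟶ _ ¿ _) _  = ≃-refl
  inbox-swap (_ ⟶ _ ¿ _) (_ ⟶ _ ! _) _  = ≃-refl

data LocalStep (r : Part) (P : Proc) : Comm → Proc → Set where
  send : ∀ {s bs u l P'} → view P ≡ out s bs u → (l , P') ∈B bs → LocalStep r P (r ⟶ s ! l) P'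
  recv : ∀ {s bs u l P'} → view P ≡ inp s bs u → (l , P') ∈B bs → LocalStep r P (s ⟶ r ¿ l) P'

LocalStep-play : ∀ {r P β P'} → LocalStep r P β P' → play β ≡ r
LocalStep-play (send _ _) = refl
LocalStep-play (recv _ _) = refl

LocalStep-out : ∀ {r P β P' s bs u} → LocalStep r P β P' → view P ≡ out s bs u →
                Σ Label λ l → β ≡ (r ⟶ s ! l) × (l , P') ∈B bs
LocalStep-out (send v m) v' with refl ← trans (sym v) v' = _ , refl , m
LocalStep-out (recv v _) v' with () ← trans (sym v) v'

LocalStep-inp : ∀ {r P β P' s bs u} → LocalStep r P β P' → view P ≡ inp s bs u →
                Σ Label λ l → β ≡ (s ⟶ r ¿ l) × (l , P') ∈B bs
LocalStep-inp (send v _) v' with () ← trans (sym v) v'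
LocalStep-inp (recv v m) v' with refl ← trans (sym v) v' = _ , refl , m

data Run (r : Part) : Proc → List Comm → Proc → Set where
  []   : ∀ {P} → Run r P [] P
  skip : ∀ {P β Π P'} → play β ≢ r → Run r P Π P' → Run r P (β ∷ Π) P'
  step : ∀ {P β P₁ Π P'} → LocalStep r P β P₁ → Run r P₁ Π P' → Run r P (β ∷ Π) P'

Run-++ : ∀ {r P Π P₁ Π' P'} → Run r P Π P₁ → Run r P₁ Π' P' → Run r P (Π ++ Π') P'
Run-++ []         run' = run'
Run-++ (skip ne run) run' = skip ne (Run-++ run run')
Run-++ (step s run) run' = step s (Run-++ run run')

Run-idle : ∀ {r P Π P'} → All (λ β → play β ≢ r) Π → Run r P Π P' → P ≡ P'
Run-idle []          []            = refl
Run-idle (_ ∷ idle)  (skip _ run)  = Run-idle idle run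
Run-idle (ne ∷ _)    (step s _)    = ⊥-elim (ne (LocalStep-play s))

dropPlay : Part → List Comm → List Comm
dropPlay r [] = []
dropPlay r (β ∷ Π) with play β ≟ r
... | yes _ = Π
... | no  _ = β ∷ dropPlay r Π

All-dropPlay : ∀ {Q : Comm → Set} r Π → All Q Π → All Q (dropPlay r Π)
All-dropPlay r []      []        = []
All-dropPlay r (β ∷ Π) (qβ ∷ qΠ) with play β ≟ r
... | yes _ = qΠ
... | no  _ = qβ ∷ All-dropPlay r Π qΠ

Run-dropPlay : ∀ {x r P Π P'} → x ≢ r → Run x P Π P' → Run x P (dropPlay r Π) P'
Run-dropPlay x≢r [] = []
Run-dropPlay {r = r} x≢r (skip {β = β} ne run) with play β ≟ r
... | yes _ = run
... | no  _ = skip ne (Run-dropPlay x≢r run)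
Run-dropPlay {r = r} x≢r (step {β = β} s run) with play β ≟ r
... | yes β↦r = ⊥-elim (x≢r (trans (sym (LocalStep-play s)) β↦r))
... | no  _   = step s (Run-dropPlay x≢r run)

record FirstMove (r : Part) (P : Proc) (Π : List Comm) (P' : Proc) : Set where
  field
    {move}  : Comm
    {after} : Proc
    local   : LocalStep r P move after
    rest    : Run r after (dropPlay r Π) P'
    reorder : Π ∼ move ∷ dropPlay r Π
    member  : move ∈ Π

dropPlay-own : ∀ {r β} Π → play β ≡ r → dropPlay r (β ∷ Π) ≡ Π
dropPlay-own {r} {β} Π e with play β ≟ r
... | yes _  = refl
... | no  ne = ⊥-elim (ne e)

dropPlay-other : ∀ {r β} Π → play β ≢ r → dropPlay r (β ∷ Π) ≡ β ∷ dropPlay r Π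
dropPlay-other {r} {β} Π ne with play β ≟ r
... | yes e = ⊥-elim (ne e)
... | no  _ = refl

Run-first : ∀ {r P Π P'} → Run r P Π P' → Any (λ β → play β ≡ r) Π → FirstMove r P Π P'
Run-first (skip ne _) (here e) = ⊥-elim (ne e)
Run-first {r} {P' = P'} (skip {β = β} {Π = Π} ne run) (there any) = record
  { local   = local
  ; rest    = subst (λ Π' → Run r after Π' P') (sym dropped) (skip ne rest)
  ; reorder = subst (λ Π' → β ∷ Π ∼ move ∷ Π') (sym dropped)
                (∼-trans (∷-∼-cong β reorder)
                         (swap-∼ (dropPlay r Π) λ e → ne (trans e (LocalStep-play local))))
  ; member  = there member }
  where
  open FirstMove (Run-first run any)
  dropped : dropPlay r (β ∷ Π) ≡ β ∷ dropPlay r Π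
  dropped = dropPlay-other Π ne
Run-first {r} {P' = P'} (step {β = β} {P₁ = P₁} {Π = Π} s run) _ = record
  { local   = s
  ; rest    = subst (λ Π' → Run r P₁ Π' P') (sym dropped) run
  ; reorder = subst (λ Π' → β ∷ Π ∼ β ∷ Π') (sym dropped) ∼-refl
  ; member  = here refl }
  where
  dropped : dropPlay r (β ∷ Π) ≡ Π
  dropped = dropPlay-own Π (LocalStep-play s)

proc-update-here : ∀ N r P → proc (N [ r ↦ P ]) r ≡ P
proc-update-here N r P with r ≟ r
... | yes _  = refl
... | no  ne = ⊥-elim (ne refl)

proc-update-there : ∀ N r P {x} → x ≢ r → proc (N [ r ↦ P ]) x ≡ proc N x
proc-update-there N r P {x} x≢r with x ≟ r
... | yes e = ⊥-elim (x≢r e)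
... | no  _ = refl

record Runs (N : Network) (Π : List Comm) (N' : Network) : Set where
  constructor runs
  field runOf : ∀ x → Run x (proc N x) Π (proc N' x)
open Runs

Runs-snoc : ∀ {N Π N' r β P} → Runs N Π N' → LocalStep r (proc N' r) β P → Runs N (Π ++ [ β ]) (N' [ r ↦ P ])
Runs-snoc {N} {Π} {N'} {r} {β} {P} rs s = runs λ x → by-cases x (x ≟ r)
  where
  by-cases : ∀ x → Dec (x ≡ r) → Run x (proc N x) (Π ++ [ β ]) (proc (N' [ r ↦ P ]) x)
  by-cases x (yes refl) = subst (Run x (proc N x) (Π ++ [ β ])) (sym (proc-update-here N' x P))
                          (Run-++ (runOf rs x) (step s []))
  by-cases x (no x≢r)   = subst (Run x (proc N x) (Π ++ [ β ])) (sym (proc-update-there N' r P x≢r))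
                          (Run-++ (runOf rs x) (skip (λ e → x≢r (trans (sym e) (LocalStep-play s))) []))

Runs-advance : ∀ {N Π N' r P} → Runs N Π N' → Run r P (dropPlay r Π) (proc N' r) →
               Runs (N [ r ↦ P ]) (dropPlay r Π) N'
Runs-advance {N} {Π} {N'} {r} {P} rs run = runs λ x → by-cases x (x ≟ r)
  where
  by-cases : ∀ x → Dec (x ≡ r) → Run x (proc (N [ r ↦ P ]) x) (dropPlay r Π) (proc N' x)
  by-cases x (yes refl) = subst (λ P₀ → Run x P₀ (dropPlay x Π) (proc N' x)) (sym (proc-update-here N x P)) run
  by-cases x (no x≢r)   = subst (λ P₀ → Run x P₀ (dropPlay r Π) (proc N' x)) (sym (proc-update-there N r P x≢r))
                          (Run-dropPlay x≢r (runOf rs x))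

unique-branch : ∀ {X : Set} {l : Label} {P P' : X} (xs : List (Label × X)) →
                Unique (map proj₁ xs) → (l , P) ∈ xs → (l , P') ∈ xs → P ≡ P'
unique-branch (_ ∷ _)  _           (here refl) (here refl) = refl
unique-branch (_ ∷ _)  (fresh ∷ _) (here refl) (there m)   = ⊥-elim (All.lookup fresh (∈-map⁺ proj₁ m) refl)
unique-branch (_ ∷ _)  (fresh ∷ _) (there m)   (here refl) = ⊥-elim (All.lookup fresh (∈-map⁺ proj₁ m) refl)
unique-branch (_ ∷ xs) (_ ∷ u)     (there m)   (there m')  = unique-branch xs u m m'

record SendRoot (N : Network) (a b : Part) (bs : List⁺ (Label × GT)) : Set where
  field
    {choices}    : List⁺ (Label × Proc)
    {distinct}   : Unique (labels choices)
    sender       : view (proc N a) ≡ out b choices distinct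
    continuation : ∀ {l P} → (l , P) ∈B choices → Σ GT λ G' → (l , G') ∈B bs × ⊢ G' ▷ (N [ a ↦ P ])

record ReceiveRoot (N : Network) (a b : Part) (bs : List⁺ (Label × GT)) : Set where
  field
    {choices}    : List⁺ (Label × Proc)
    {distinct}   : Unique (labels choices)
    receiver     : view (proc N b) ≡ inp a choices distinct
    continuation : ∀ {l G'} → (l , G') ∈B bs → Σ Proc λ P → (l , P) ∈B choices × ⊢ G' ▷ (N [ b ↦ P ])

typed-send : ∀ {G N a b bs u v} → ⊢ G ▷ N → gview G ≡ com a b snd bs u v → SendRoot N a b bs
typed-send ty e with ⊢_▷_.rule ty
... | tEnd e' _   with () ← trans (sym e) e'
... | tIn e' _ _  with () ← trans (sym e) e'
... | tOut {Pbs = Pbs} {v = w} e' sender ch back with refl ← trans (sym e) e' =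
  record { sender = sender ; continuation = continuation }
  where
  continuation : ∀ {l P} → (l , P) ∈B Pbs → Σ GT λ G' → (l , G') ∈B _ × ⊢ G' ▷ (_ [ _ ↦ P ])
  continuation mP with back mP
  ... | G' , mG with ch mG
  ... | P' , mP' , ty' , _ with refl ← unique-branch (toList Pbs) w mP mP' = G' , mG , ty'

typed-receive : ∀ {G N a b bs u v} → ⊢ G ▷ N → gview G ≡ com a b rcv bs u v → ReceiveRoot N a b bs
typed-receive ty e with ⊢_▷_.rule ty
... | tEnd e' _      with () ← trans (sym e) e'
... | tOut e' _ _ _  with () ← trans (sym e) e'
... | tIn e' receiver ch with refl ← trans (sym e) e' =
  record { receiver = receiver ; continuation = λ mG → let P , mP , ty' , _ = ch mG in P , mP , ty' }

balanced-send : ∀ {G M a b bs u v l G'} → Balanced G M → gview G ≡ com a b snd bs u v →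
                (l , G') ∈B bs → Balanced G' (M ++ [ ⟨ a , l , b ⟩ ])
balanced-send bal e mG with Balanced.unfoldBal bal
... | bEnd e' _         with () ← trans (sym e) e'
... | bIn e' _ _ _ _    with () ← trans (sym e) e'
... | bOut e' _ next    with refl ← trans (sym e) e' = next mG

record BalancedReceive (M : Queue) (a b : Part) (bs : List⁺ (Label × GT)) : Set where
  field
    {label}  : Label
    {next}   : GT
    {remaining} : Queue
    queued      : M ≈Q (⟨ a , label , b ⟩ ∷ remaining)
    chosen      : (label , next) ∈B bs
    balanced    : Balanced next remaining

balanced-receive : ∀ {G M a b bs u v} → Balanced G M → gview G ≡ com a b rcv bs u v → BalancedReceive M a b bs
balanced-receive bal e with Balanced.unfoldBal bal
... | bEnd e' _              with () ← trans (sym e) e'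
... | bOut e' _ _            with () ← trans (sym e) e'
... | bIn e' queued mG _ bal' with refl ← trans (sym e) e' =
  record { queued = queued ; chosen = mG ; balanced = bal' }

balanced⇒read : ∀ {G M} → Balanced G M → M ≢ [] → Read G M
balanced⇒read bal M≢[] with Balanced.unfoldBal bal
... | bEnd _ M≡[]     = ⊥-elim (M≢[] M≡[])
... | bOut _ read _   = read
... | bIn _ _ _ read _ = read

-- Distance to a receive in a global type

data Reaches (p q : Part) : ℕ → GT → Set where
  here  : ∀ {n G bs u v} → gview G ≡ com p q rcv bs u v → Reaches p q n G
  there : ∀ {n G a b d bs u v} → gview G ≡ com a b d bs u v →
          (∀ {l G'} → (l , G') ∈B bs → Reaches p q n G') → Reaches p q (suc n) G

Reaches-mono : ∀ {p q m n G} → m ≤ n → Reaches p q m G → Reaches p q n G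
Reaches-mono _         (here e)       = here e
Reaches-mono (s≤s m≤n) (there e next) = there e λ mG → Reaches-mono m≤n (next mG)

Reaches-com : ∀ {p q G a b d bs u v} → gview G ≡ com a b d bs u v →
              (∀ {l G'} → (l , G') ∈B bs → ∃ λ n → Reaches p q n G') → ∃ λ n → Reaches p q n G
Reaches-com {p} {q} {bs = bs} e next = let n , all = bound (toList bs) next in suc n , there e all
  where
  bound : ∀ xs → (∀ {l G'} → (l , G') ∈ xs → ∃ λ n → Reaches p q n G') →
          ∃ λ n → ∀ {l G'} → (l , G') ∈ xs → Reaches p q n G'
  bound []       _    = 0 , λ ()
  bound (_ ∷ xs) next with next (here refl) | bound xs (next ∘ there)
  ... | n₀ , r₀ | n₁ , r₁ = n₀ ⊔ n₁ , λ where
    (here refl) → Reaches-mono (m≤m⊔n n₀ n₁) r₀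
    (there mG)  → Reaches-mono (m≤n⊔m n₀ n₁) (r₁ mG)

read⇒Reaches : ∀ {p q l t G M} → Read G M → channel p q M ≡ l ∷ t → ∃ λ n → Reaches p q n G
read⇒Reaches rEmp ()
read⇒Reaches (rOut e next) head = Reaches-com e λ mG → read⇒Reaches (next mG) head
read⇒Reaches {p} {q} (rHit {M' = M'} {a} {b} {l = l'} e M≈ _ next) head with onChannel? p q ⟨ a , l' , b ⟩
... | yes (refl , refl) = 0 , here e
... | no off = Reaches-com e λ mG → read⇒Reaches (next mG)
                 (trans (sym (trans (at (≈Q⇒≃ M≈) p q) (channel-there p q _ M' off))) head)
read⇒Reaches {p} {q} (rMiss {p = a} {b} e _ next) head with a ≟ p | b ≟ q
... | yes refl | yes refl = 0 , here e
... | _ | _ = Reaches-com e λ mG → read⇒Reaches (next mG) head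

-- Shadowing a session by a global type

-- S is reached from the virtual session net₀ ∥ queue₀ by performing Π, which G does not
-- yet account for.
record Tracks (G : GT) (Π : List Comm) (S : Session) : Set where
  field
    {net₀}   : Network
    {queue₀} : Queue
    typed    : ⊢ G ▷ net₀
    balanced : Balanced G queue₀
    pending  : Runs net₀ Π (net S)
    channels : queue₀ ++ outbox Π ≃ inbox Π ++ queue S

Tracks-step : ∀ {G Π S S' β} → Tracks G Π S → S ─[ β ]→ S' → Tracks G (Π ++ [ β ]) S'
Tracks-step {Π = Π} tr (send {M = M} {p} {q} {l = l} v m) = record
  { typed = typed ; balanced = balanced ; pending = Runs-snoc pending (send v m) ; channels = channels' }
  where
  open Tracks tr
  open SetoidReasoning ≃-setoid
  μ = ⟨ p , l , q ⟩
  channels' : queue₀ ++ outbox (Π ++ [ p ⟶ q ! l ]) ≃ inbox (Π ++ [ p ⟶ q ! l ]) ++ (M ++ [ μ ])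
  channels' = begin
    queue₀ ++ outbox (Π ++ [ p ⟶ q ! l ]) ≡⟨ cong (queue₀ ++_) (outbox-++ Π _) ⟩
    queue₀ ++ (outbox Π ++ [ μ ])          ≡⟨ ++-assoc queue₀ _ _ ⟨
    (queue₀ ++ outbox Π) ++ [ μ ]          ≈⟨ ++-cong channels ≃-refl ⟩
    (inbox Π ++ M) ++ [ μ ]                ≡⟨ ++-assoc (inbox Π) M _ ⟩
    inbox Π ++ (M ++ [ μ ])                ≡⟨ cong (_++ (M ++ [ μ ])) (trans (inbox-++ Π _) (++-identityʳ _)) ⟨
    inbox (Π ++ [ p ⟶ q ! l ]) ++ (M ++ [ μ ]) ∎
Tracks-step {Π = Π} tr (recv {M = M} {M'} {p} {q} {l = l} v m M≈) = record
  { typed = typed ; balanced = balanced ; pending = Runs-snoc pending (recv v m) ; channels = channels' }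
  where
  open Tracks tr
  open SetoidReasoning ≃-setoid
  channels' : queue₀ ++ outbox (Π ++ [ p ⟶ q ¿ l ]) ≃ inbox (Π ++ [ p ⟶ q ¿ l ]) ++ M'
  channels' = begin
    queue₀ ++ outbox (Π ++ [ p ⟶ q ¿ l ]) ≡⟨ cong (queue₀ ++_) (trans (outbox-++ Π _) (++-identityʳ _)) ⟩
    queue₀ ++ outbox Π                     ≈⟨ channels ⟩
    inbox Π ++ M                           ≈⟨ ++-cong ≃-refl (≈Q⇒≃ M≈) ⟩
    inbox Π ++ (⟨ p , l , q ⟩ ∷ M')        ≡⟨ ++-assoc (inbox Π) _ M' ⟨
    (inbox Π ++ [ ⟨ p , l , q ⟩ ]) ++ M'   ≡⟨ cong (_++ M') (inbox-++ Π _) ⟨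
    inbox (Π ++ [ p ⟶ q ¿ l ]) ++ M'       ∎

record Synced (bs : List⁺ (Label × GT)) (Π : List Comm) (S : Session) : Set where
  field
    {label}  : Label
    {next}   : GT
    chosen   : (label , next) ∈B bs
    tracking : Tracks next Π S

Tracks-sync-send : ∀ {G Π S a b bs u v} → Tracks G Π S → gview G ≡ com a b snd bs u v →
                   Any (λ β → play β ≡ a) Π → Synced bs (dropPlay a Π) S
Tracks-sync-send {Π = Π} {S} {a} {b} tr e a-pending
  with Run-first (runOf (Tracks.pending tr) a) a-pending | typed-send (Tracks.typed tr) e
... | record { local = s ; rest = run ; reorder = reorder } | root
  with LocalStep-out s (SendRoot.sender root)
... | l , refl , mP with SendRoot.continuation root mP
... | G' , mG , ty' = record
  { chosen   = mG
  ; tracking = record { typed = ty' ; balanced = balanced-send balanced e mG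
                      ; pending = Runs-advance pending run ; channels = channels' } }
  where
  open Tracks tr
  open SetoidReasoning ≃-setoid
  Π' = dropPlay a Π
  channels' : (queue₀ ++ [ ⟨ a , l , b ⟩ ]) ++ outbox Π' ≃ inbox Π' ++ queue S
  channels' = begin
    (queue₀ ++ [ ⟨ a , l , b ⟩ ]) ++ outbox Π' ≡⟨ ++-assoc queue₀ _ _ ⟩
    queue₀ ++ outbox (a ⟶ b ! l ∷ Π')         ≈⟨ ++-cong ≃-refl (≃-sym (outboxes reorder)) ⟩
    queue₀ ++ outbox Π                         ≈⟨ channels ⟩
    inbox Π ++ queue S                         ≈⟨ ++-cong (inboxes reorder) ≃-refl ⟩
    inbox Π' ++ queue S                        ∎

Tracks-sync-receive : ∀ {G Π S a b bs u v} → Tracks G Π S → gview G ≡ com a b rcv bs u v →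
                      Any (λ β → play β ≡ b) Π → Synced bs (dropPlay b Π) S
Tracks-sync-receive {Π = Π} {S} {a} {b} tr e b-pending
  with Run-first (runOf (Tracks.pending tr) b) b-pending | typed-receive (Tracks.typed tr) e
     | balanced-receive (Tracks.balanced tr) e
... | record { local = s ; rest = run ; reorder = reorder } | root | delivery
  with LocalStep-inp s (ReceiveRoot.receiver root)
... | l , refl , mP with ∷-cancel heads
  where
  open Tracks tr
  open BalancedReceive delivery
  open SetoidReasoning ≃-setoid
  Π' = dropPlay b Π
  heads : ⟨ a , label , b ⟩ ∷ (remaining ++ outbox Π') ≃ ⟨ a , l , b ⟩ ∷ (inbox Π' ++ queue S)
  heads = begin
    (⟨ a , label , b ⟩ ∷ remaining) ++ outbox Π' ≈⟨ ++-cong (≃-sym (≈Q⇒≃ queued)) ≃-refl ⟩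
    queue₀ ++ outbox (a ⟶ b ¿ l ∷ Π')      ≈⟨ ++-cong ≃-refl (≃-sym (outboxes reorder)) ⟩
    queue₀ ++ outbox Π                      ≈⟨ channels ⟩
    inbox Π ++ queue S                      ≈⟨ ++-cong (inboxes reorder) ≃-refl ⟩
    inbox (a ⟶ b ¿ l ∷ Π') ++ queue S      ∎
... | refl , channels' with ReceiveRoot.continuation root (BalancedReceive.chosen delivery)
... | P , mP' , ty'
  with refl ← unique-branch (toList (ReceiveRoot.choices root)) (ReceiveRoot.distinct root) mP mP' =
  record { chosen = BalancedReceive.chosen delivery
         ; tracking = record { typed = ty' ; balanced = BalancedReceive.balanced delivery
                             ; pending = Runs-advance (Tracks.pending tr) run ; channels = channels' } }

Tracks-sync : ∀ {G Π S a b d bs u v} → Tracks G Π S → gview G ≡ com a b d bs u v →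
              Any (λ β → play β ≡ playOf a b d) Π → Synced bs (dropPlay (playOf a b d) Π) S
Tracks-sync {d = snd} = Tracks-sync-send
Tracks-sync {d = rcv} = Tracks-sync-receive

RootIdle : GT → List Comm → Set
RootIdle G Π = ∀ {a b d bs u v} → gview G ≡ com a b d bs u v → All (λ β → play β ≢ playOf a b d) Π

Tracks-enabled : ∀ {G Π S a b d bs u v} → Tracks G Π S → RootIdle G Π → gview G ≡ com a b d bs u v →
                 Σ Comm λ β → play β ≡ playOf a b d × HasTrans S β
Tracks-enabled {S = S} {a} {d = snd} tr idle e =
  _ , refl , _ , send {N = net S} (trans (cong view (sym unmoved)) sender) (here refl)
  where
  open Tracks tr
  open SendRoot (typed-send typed e)
  unmoved : proc net₀ a ≡ proc (net S) a
  unmoved = Run-idle (idle e) (runOf pending a)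
Tracks-enabled {Π = Π} {S} {a} {b} {rcv} tr idle e
  with typed-receive (Tracks.typed tr) e | balanced-receive (Tracks.balanced tr) e
... | root | delivery with ReceiveRoot.continuation root (BalancedReceive.chosen delivery)
... | _ , mP , _ = _ , refl , _ , recv (trans (cong view (sym unmoved)) (ReceiveRoot.receiver root)) mP
                                       (proj₂ (channel-head a b (queue S) queue-head))
  where
  open Tracks tr
  open BalancedReceive delivery
  unmoved : proc net₀ b ≡ proc (net S) b
  unmoved = Run-idle (idle e) (runOf pending b)
  queue-head : channel a b (queue S) ≡ label ∷ channel a b (remaining ++ outbox Π)
  queue-head = begin
    channel a b (queue S)                               ≡⟨ cong (_++ channel a b (queue S)) (inbox-idle Π (idle e)) ⟨
    channel a b (inbox Π) ++ channel a b (queue S)      ≡⟨ channel-++ a b (inbox Π) (queue S) ⟨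
    channel a b (inbox Π ++ queue S)                    ≡⟨ at channels a b ⟨
    channel a b (queue₀ ++ outbox Π)                    ≡⟨ at (++-cong (≈Q⇒≃ queued) ≃-refl) a b ⟩
    channel a b (⟨ a , label , b ⟩ ∷ remaining ++ outbox Π) ≡⟨ channel-here a b label _ ⟩
    label ∷ channel a b (remaining ++ outbox Π)          ∎
    where open ≡-Reasoning

_≟ᶜ_ : DecidableEquality Comm
(a ⟶ b ! l) ≟ᶜ (a' ⟶ b' ! l') =
  map′ (λ { (refl , refl , refl) → refl }) (λ { refl → refl , refl , refl }) (a ≟ a' ×-dec b ≟ b' ×-dec l ≟ l')
(a ⟶ b ¿ l) ≟ᶜ (a' ⟶ b' ¿ l') =
  map′ (λ { (refl , refl , refl) → refl }) (λ { refl → refl , refl , refl }) (a ≟ a' ×-dec b ≟ b' ×-dec l ≟ l')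
(_ ⟶ _ ! _) ≟ᶜ (_ ⟶ _ ¿ _) = no λ ()
(_ ⟶ _ ¿ _) ≟ᶜ (_ ⟶ _ ! _) = no λ ()

open import Data.List.Membership.DecPropositional _≟ᶜ_ using (_∈?_)

maxCoherent-covers : ∀ {S Δ β} → MaxCoherent S Δ → HasTrans S β → Any (λ β' → play β' ≡ play β) Δ
maxCoherent-covers {S} {Δ} {β} ((_ , distinct , enabled) , maximal) t
  with any? (λ β' → play β' ≟ play β) Δ
... | yes covered  = covered
... | no uncovered =
  ⊥-elim (uncovered (Any.map (λ { refl → refl }) (maximal (β ∷ Δ) extended there (here refl))))
  where
  extended : Coherent S (β ∷ Δ)
  extended = (λ ()) , All.map (λ ne e → ne (sym e)) (¬Any⇒All¬ Δ uncovered) ∷ distinct , t ∷ enabled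

receive-from : ∀ {S S' β r a bs w} → S ─[ β ]→ S' → view (proc (net S) r) ≡ inp a bs w → play β ≡ r →
               ∃ λ l' → β ≡ (a ⟶ r ¿ l')
receive-from (send v _) r-receives refl with () ← trans (sym v) r-receives
receive-from (recv v _ _) r-receives refl with refl ← trans (sym v) r-receives = _ , refl

-- Consumption of the head of a channel

module Consumption (p q : Part) (l : Label) where

  target : Comm
  target = p ⟶ q ¿ l

  NotReceiveOn : Comm → Set
  NotReceiveOn β = ∀ l' → β ≢ (p ⟶ q ¿ l')

  HeadIs : Session → Set
  HeadIs S = ∃ λ t → channel p q (queue S) ≡ l ∷ t

  receive-label : ∀ {S S' l'} → HeadIs S → S ─[ p ⟶ q ¿ l' ]→ S' → l' ≡ l
  receive-label {l' = l'} (_ , head) (recv {M' = M'} _ _ M≈) =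
    ∷-injectiveˡ (trans (sym (trans (at (≈Q⇒≃ M≈) p q) (channel-here p q l' M'))) head)

  HeadIs-step : ∀ {S S' β} → HeadIs S → S ─[ β ]→ S' → β ≢ target → HeadIs S'
  HeadIs-step (t , head) (send {M = M} {x} {y} {l = l'} _ _) _ =
    t ++ channel p q [ ⟨ x , l' , y ⟩ ] ,
    trans (channel-++ p q M _) (cong (_++ channel p q [ ⟨ x , l' , y ⟩ ]) head)
  HeadIs-step (t , head) s@(recv {M' = M'} {x} {y} {l = l'} _ _ M≈) β≢target
    with onChannel? p q ⟨ x , l' , y ⟩
  ... | yes (refl , refl) = ⊥-elim (β≢target (cong (p ⟶ q ¿_) (receive-label (t , head) s)))
  ... | no off = t , trans (sym (trans (at (≈Q⇒≃ M≈) p q) (channel-there p q _ M' off))) head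

  record Invariant (G : GT) (Π : List Comm) (S : Session) : Set where
    field
      tracks     : Tracks G Π S
      no-receive : All NotReceiveOn Π
      head       : HeadIs S

  Invariant-step : ∀ {G Π S S' β} → Invariant G Π S → S ─[ β ]→ S' → β ≢ target → Invariant G (Π ++ [ β ]) S'
  Invariant-step inv s β≢target = record
    { tracks     = Tracks-step tracks s
    ; no-receive = ++⁺ no-receive ((λ { l' refl → β≢target (cong (p ⟶ q ¿_) (receive-label head s)) }) ∷ [])
    ; head       = HeadIs-step head s β≢target }
    where open Invariant inv

  Invariant-steps : ∀ {G Π S S' Δ} → Invariant G Π S → Steps S Δ S' → target ∉ Δ → Invariant G (Π ++ Δ) S'
  Invariant-steps {Π = Π} inv [] _ = subst (λ Π' → Invariant _ Π' _) (sym (++-identityʳ Π)) inv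
  Invariant-steps {Π = Π} inv (_∷_ {β = β} {Δ = Δ} s ss) ∉Δ =
    subst (λ Π' → Invariant _ Π' _) (++-assoc Π [ β ] Δ)
      (Invariant-steps (Invariant-step inv s λ { refl → ∉Δ (here refl) }) ss (∉Δ ∘ there))

  Invariant-sync : ∀ {G Π S a b d bs u v} → Invariant G Π S → gview G ≡ com a b d bs u v →
                   Any (λ β → play β ≡ playOf a b d) Π →
                   Σ GT λ G' → (∃ λ l' → (l' , G') ∈B bs) × Invariant G' (dropPlay (playOf a b d) Π) S
  Invariant-sync inv e pending =
    next , (label , chosen) , record { tracks = tracking ; no-receive = All-dropPlay _ _ no-receive ; head = head }
    where
    open Invariant inv
    open Synced (Tracks-sync tracks e pending)

  receiver-idle : ∀ {G Π S bs u v} → Invariant G Π S → gview G ≡ com p q rcv bs u v → ¬ Any (λ β → play β ≡ q) Π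
  receiver-idle inv e q-pending
    with Run-first (runOf (Tracks.pending (Invariant.tracks inv)) q) q-pending
  ... | record { local = s ; member = β∈Π }
    with LocalStep-inp s (ReceiveRoot.receiver (typed-receive (Tracks.typed (Invariant.tracks inv)) e))
  ... | l' , refl , _ = All.lookup (Invariant.no-receive inv) β∈Π l' refl

  root-idle : ∀ {G Π a b d bs u v} → gview G ≡ com a b d bs u v →
              ¬ Any (λ β → play β ≡ playOf a b d) Π → RootIdle G Π
  root-idle {Π = Π} e none e' with refl ← trans (sym e) e' = ¬Any⇒All¬ Π none

  record Waiting (n : ℕ) (S : Session) : Set where
    field
      {G}       : GT
      {Π}       : List Comm
      invariant : Invariant G Π S
      idle      : RootIdle G Π
      reaches   : Reaches p q n G

  Waiting-mono : ∀ {m n S} → m ≤ n → Waiting m S → Waiting n S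
  Waiting-mono m≤n w = record { invariant = invariant ; idle = idle ; reaches = Reaches-mono m≤n reaches }
    where open Waiting w

  settle : ∀ {G Π S n} → Invariant G Π S → Reaches p q n G → Waiting n S
  settle {G} inv (here e) = record
    { invariant = inv ; idle = root-idle {G} e (receiver-idle inv e) ; reaches = here e }
  settle {G} {Π} inv (there {a = a} {b} {d} e next) with any? (λ β → play β ≟ playOf a b d) Π
  ... | no none = record { invariant = inv ; idle = root-idle {G} e none ; reaches = there e next }
  ... | yes pending with Invariant-sync inv e pending
  ... | _ , (_ , mG) , inv' = Waiting-mono (n≤1+n _) (settle inv' (next mG))

  target-forced : ∀ {G Π S S' β bs u v} → Invariant G Π S → RootIdle G Π → gview G ≡ com p q rcv bs u v →
                  S ─[ β ]→ S' → play β ≡ q → β ≡ target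
  target-forced {S = S} inv idle e s played with receive-from s q-receives played
    where
    open Tracks (Invariant.tracks inv)
    q-receives : view (proc (net S) q) ≡ inp p _ _
    q-receives = trans (cong view (sym (Run-idle (idle e) (runOf pending q))))
                       (ReceiveRoot.receiver (typed-receive typed e))
  ... | _ , refl = cong (p ⟶ q ¿_) (receive-label (Invariant.head inv) s)

  Waiting-step : ∀ {n S S' Δ} → Waiting n S → S ⇒[ Δ ] S' → target ∈ Δ ⊎ Σ ℕ λ n' → n ≡ suc n' × Waiting n' S'
  Waiting-step record { invariant = inv ; idle = idle ; reaches = here e } (maxcoh , _)
    with Tracks-enabled (Invariant.tracks inv) idle e
  ... | _ , played , t with find (maxCoherent-covers maxcoh t)
  ... | β , β∈Δ , same-player =
    inj₁ (subst (_∈ _) (target-forced inv idle e (proj₂ (All.lookup (proj₂ (proj₂ (proj₁ maxcoh))) β∈Δ))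
                                       (trans same-player played)) β∈Δ)
  Waiting-step {Δ = Δ} record { invariant = inv ; idle = idle ; reaches = there {n = n'} e next } (maxcoh , steps)
    with target ∈? Δ
  ... | yes target∈Δ = inj₁ target∈Δ
  ... | no  target∉Δ with Tracks-enabled (Invariant.tracks inv) idle e
  ... | _ , played , t
    with Invariant-sync (Invariant-steps inv steps target∉Δ) e
           (++⁺ʳ _ (Any.map (λ same → trans same played) (maxCoherent-covers maxcoh t)))
  ... | _ , (_ , mG) , inv' = inj₂ (n' , refl , settle inv' (next mG))

  Waiting-not-stuck : ∀ {n S} → Waiting n S → ¬ Stuck S
  Waiting-not-stuck record { invariant = inv ; idle = idle ; reaches = reaches } stuck with reaches
  ... | here e      = let β , _ , t = Tracks-enabled (Invariant.tracks inv) idle e in stuck β t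
  ... | there e _   = let β , _ , t = Tracks-enabled (Invariant.tracks inv) idle e in stuck β t

  start : ∀ {G N M M'} → ⊢ G ▷ N → Balanced G M → M ≈Q (⟨ p , l , q ⟩ ∷ M') → ∃ λ n → Waiting n (N ∥ M)
  start {G} {N} {M} {M'} typed balanced M≈ =
    proj₁ reached , record { invariant = invariant ; idle = λ _ → [] ; reaches = proj₂ reached }
    where
    head : channel p q M ≡ l ∷ channel p q M'
    head = trans (at (≈Q⇒≃ M≈) p q) (channel-here p q l M')
    M≢[] : M ≢ []
    M≢[] refl with () ← head
    reached : ∃ λ n → Reaches p q n G
    reached = read⇒Reaches (balanced⇒read balanced M≢[]) head
    invariant : Invariant G [] (N ∥ M)
    invariant = record
      { tracks     = record { typed = typed ; balanced = balanced ; pending = runs λ _ → []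
                            ; channels = ≡⇒≃ (++-identityʳ M) }
      ; no-receive = []
      ; head       = _ , head }

  consumed-finite : ∀ {S₀} (nxt : ℕ → Session) (Δ : ℕ → List Comm) k →
                    (∀ i → i < k → curFrom S₀ nxt i ⇒[ Δ i ] curFrom S₀ nxt (suc i)) → Stuck (curFrom S₀ nxt k) →
                    ∀ {n} i → i ≤ k → Waiting n (curFrom S₀ nxt i) → Σ ℕ λ h → h < k × target ∈ Δ h
  consumed-finite nxt Δ k steps stuck i i≤k w with m≤n⇒m<n∨m≡n i≤k
  ... | inj₂ refl = ⊥-elim (Waiting-not-stuck w stuck)
  ... | inj₁ i<k with Waiting-step w (steps i i<k)
  ... | inj₁ hit               = i , i<k , hit
  ... | inj₂ (_ , refl , w') = consumed-finite nxt Δ k steps stuck (suc i) i<k w'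

  consumed-infinite : ∀ {S₀} (nxt : ℕ → Session) (Δ : ℕ → List Comm) →
                      (∀ i → curFrom S₀ nxt i ⇒[ Δ i ] curFrom S₀ nxt (suc i)) →
                      ∀ {n} i → Waiting n (curFrom S₀ nxt i) → Σ ℕ λ h → target ∈ Δ h
  consumed-infinite nxt Δ steps i w with Waiting-step w (steps i)
  ... | inj₁ hit               = i , hit
  ... | inj₂ (_ , refl , w') = consumed-infinite nxt Δ steps (suc i) w'

  consumed : ∀ {n S} → Waiting n S → (c : Complete S) → Σ ℕ λ h → IsStep c h × target ∈ Complete.Δ c h
  consumed w c with Complete.shape c
  ... | inj₁ (k , steps , stuck) = consumed-finite (Complete.nxt c) (Complete.Δ c) k steps stuck 0 z≤n w
  ... | inj₂ steps = let h , hit = consumed-infinite (Complete.nxt c) (Complete.Δ c) steps 0 w in h , tt , hit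

theorem4p19 : (G : GT) (N : Network) (M : Queue) →
    RegularG G → (∀ p → RegularP (proc N p)) →
    ⊢ G ▷ N → Bounded G → Balanced G M →
    QueueConsuming (N ∥ M)
theorem4p19 G N M _ _ typed _ balanced p l q M' M≈ =
  Consumption.consumed p q l (proj₂ (Consumption.start p q l typed balanced M≈))
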